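{- Each of the following families $\mathcal{F}$ is feasible, i.e. for every $n\ge 1$ and every integer $0\le m\le\binom{n}{2}$ there is a graph in $\mathcal{F}$ with $n$ vertices and $m$ edges: (1) graphs with no induced $K_{1,r}$, for any fixed $r \geq 3$; (2) graphs with no induced $P_r$, for any fixed $r\geq 3$, where $P_r$ denotes the path with $r$ edges; (3) graphs with no induced $rK_2$, for any fixed $r\geq 2$, where $rK_2$ is the disjoint union of $r$ edges; (4) chordal graphs.
   Context: All graphs are finite and simple. $K_{1,r}$ is the star with $r$ leaves. A graph is chordal if every cycle of length at least 4 has a chord. -}

module Defs where

open import Data.Nat using (ℕ; zero; suc; _+_; _*_; _≤_; _≡ᵇ_; _<ᵇ_; ⌊_/2⌋)
open import Data.Nat.Combinatorics using (_C_)
open import Data.Fin using (Fin; toℕ)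
open import Data.Bool using (Bool; true; false; _∧_; _∨_; not; _xor_; if_then_else_)
open import Data.Product using (Σ; ∃; ∃-syntax; _×_)
open import Relation.Binary.PropositionalEquality using (_≡_; _≢_)
open import Function.Definitions using (Injective)
open import Relation.Nullary using (¬_)

record Graph (n : ℕ) : Set where
  field
    adj    : Fin n → Fin n → Bool
    sym    : ∀ i j → adj i j ≡ adj j i
    irrefl : ∀ i → adj i i ≡ false
open Graph public

sumFin : ∀ {k} → (Fin k → ℕ) → ℕ
sumFin {zero}  f = 0
sumFin {suc k} f = f Fin.zero + sumFin (λ i → f (Fin.suc i))

edges : ∀ {n} → Graph n → ℕ
edges G = sumFin (λ i → sumFin (λ j →
  if (toℕ j <ᵇ toℕ i) ∧ adj G i j then 1 else 0))

InducedCopy : ∀ {k n} → (Fin k → Fin k → Bool) → Graph n → Set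
InducedCopy {k} {n} H G =
  Σ (Fin k → Fin n) λ f →
    Injective _≡_ _≡_ f × (∀ a b → adj G (f a) (f b) ≡ H a b)

Free : ∀ {k} → (Fin k → Fin k → Bool) → ∀ {n} → Graph n → Set
Free H G = ¬ InducedCopy H G

isZero : ∀ {k} → Fin k → Bool
isZero Fin.zero    = true
isZero (Fin.suc _) = false

-- Star K_{1,r}: vertex 0 is the centre, vertices 1..r the leaves.
star : (r : ℕ) → Fin (suc r) → Fin (suc r) → Bool
star r i j = isZero i xor isZero j

path : (r : ℕ) → Fin (suc r) → Fin (suc r) → Bool
path r i j = (suc (toℕ i) ≡ᵇ toℕ j) ∨ (suc (toℕ j) ≡ᵇ toℕ i)

-- r K_2: vertices 0..2r-1, edges {2t, 2t+1}.
matching : (r : ℕ) → Fin (r * 2) → Fin (r * 2) → Bool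
matching r i j = not (toℕ i ≡ᵇ toℕ j) ∧ (⌊ toℕ i /2⌋ ≡ᵇ ⌊ toℕ j /2⌋)

cycAdj : (k : ℕ) → Fin k → Fin k → Bool
cycAdj k i j = (suc (toℕ i) ≡ᵇ toℕ j) ∨ (suc (toℕ j) ≡ᵇ toℕ i)
  ∨ ((toℕ i ≡ᵇ 0) ∧ (suc (toℕ j) ≡ᵇ k))
  ∨ ((toℕ j ≡ᵇ 0) ∧ (suc (toℕ i) ≡ᵇ k))

Chordal : ∀ {n} → Graph n → Set
Chordal {n} G =
  ∀ k → 4 ≤ k → (f : Fin k → Fin n) → Injective _≡_ _≡_ f →
  (∀ i j → cycAdj k i j ≡ true → adj G (f i) (f j) ≡ true) →
  ∃[ i ] ∃[ j ] (i ≢ j × cycAdj k i j ≡ false × adj G (f i) (f j) ≡ true)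

Feasible : (∀ {n} → Graph n → Set) → Set
Feasible F = ∀ n → 1 ≤ n → ∀ m → m ≤ n C 2 →
  Σ (Graph n) λ G → F G × edges G ≡ m

-- Let colexGraph m n be the graph on 0, …, n-1 whose edges are the first m pairs in colex
-- order, {a < b} having rank b C 2 + a; it has min(m, n C 2) edges. If a vertex x has a
-- neighbour then x C 2 < m, so every pair below x, having rank below x C 2, is an edge. Hence
-- among any four vertices the largest one, if not isolated, lies above a triangle. But the
-- first four vertices of K_{1,r}, P_r and rK_2 induce K_{1,3}, P_3 and 2K_2, in which every
-- vertex has a neighbour and every three vertices miss an edge; and on four consecutive
-- vertices of a cycle of length at least 4 the same observation produces a chord.
module Submission where

open import Defs hiding (sym)
open import Data.Bool using (Bool; true; false; _∧_; if_then_else_)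
open import Data.Fin using (Fin; zero; suc; toℕ; _↑ˡ_)
open import Data.Fin.Patterns using (0F; 1F; 2F; 3F)
open import Data.Fin.Properties using (toℕ-injective; toℕ-inject₁; toℕ-fromℕ; toℕ<n; ↑ˡ-injective)
open import Data.Nat using (ℕ; zero; suc; _+_; _*_; _∸_; _⊓_; _⊔_; _≤_; _<_; _<ᵇ_; z≤n; s≤s)
open import Data.Nat.Combinatorics using (_C_; nC1≡n; nCk+nC[k+1]≡[n+1]C[k+1])
open import Data.Nat.Properties
open import Data.Product using (_×_; _,_; ∃-syntax; ∃₂)
open import Data.Sum using (inj₁; inj₂)
open import Function using (_∘_; mk⇔)
open import Function.Definitions using (Injective)
open import Relation.Binary.PropositionalEquality
open import Relation.Binary.Definitions using (tri<; tri≈; tri>)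
open import Relation.Nullary using (Dec; yes; no; does; ¬?; _×-dec_; contradiction)
open import Relation.Nullary.Decidable using (does-⇔; dec-true; dec-false)
open import Algebra.Properties.Monoid.Sum +-0-monoid using (sum; sum-cong-≗; sum-init-last)

suc-C2 : ∀ n → suc n C 2 ≡ n C 2 + n
suc-C2 n = begin
  suc n C 2        ≡⟨ nCk+nC[k+1]≡[n+1]C[k+1] n 1 ⟨
  n C 1 + n C 2    ≡⟨ cong (_+ n C 2) (nC1≡n n) ⟩
  n + n C 2        ≡⟨ +-comm n (n C 2) ⟩
  n C 2 + n        ∎
  where open ≡-Reasoning

C2-mono : ∀ {a b} → a ≤ b → a C 2 ≤ b C 2
C2-mono {zero}  _         = z≤n
C2-mono {suc a} {suc b} (s≤s a≤b) rewrite suc-C2 a | suc-C2 b = +-mono-≤ (C2-mono a≤b) a≤b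

⊓<⊔ : ∀ {u v} → u ≢ v → u ⊓ v < u ⊔ v
⊓<⊔ {u} {v} u≢v with <-cmp u v
... | tri< u<v _ _ rewrite m≤n⇒m⊓n≡m (<⇒≤ u<v) | m≤n⇒m⊔n≡n (<⇒≤ u<v) = u<v
... | tri≈ _ u≡v _ = contradiction u≡v u≢v
... | tri> _ _ v<u rewrite m≥n⇒m⊓n≡n (<⇒≤ v<u) | m≥n⇒m⊔n≡m (<⇒≤ v<u) = v<u

+<⇒<∸ : ∀ t {b m} → t + b < m → b < m ∸ t
+<⇒<∸ t {b} {m} lt = m+n≤o⇒m≤o∸n (suc b) (subst (_≤ m) (cong suc (+-comm t b)) lt)

<∸⇒+< : ∀ t {b m} → b < m ∸ t → t + b < m
<∸⇒+< t {b} {m} lt = subst (_≤ m) (cong suc (+-comm b t))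
  (m≤o∸n⇒m+n≤o (suc b) (<⇒≤ (m∸n≢0⇒n<m (>⇒≢ (≤-trans (s≤s z≤n) lt)))) lt)

⊓-+-∸ : ∀ m t n → m ⊓ t + n ⊓ (m ∸ t) ≡ m ⊓ (t + n)
⊓-+-∸ m t n with ≤-total m t
... | inj₁ m≤t rewrite m≤n⇒m⊓n≡m m≤t | m≤n⇒m∸n≡0 m≤t | ⊓-zeroʳ n
  = trans (+-identityʳ m) (sym (m≤n⇒m⊓n≡m (≤-trans m≤t (m≤m+n t n))))
... | inj₂ t≤m rewrite m≥n⇒m⊓n≡n t≤m = begin
  t + n ⊓ (m ∸ t)          ≡⟨ +-distribˡ-⊓ t n (m ∸ t) ⟩
  (t + n) ⊓ (t + (m ∸ t))  ≡⟨ cong ((t + n) ⊓_) (m+[n∸m]≡n t≤m) ⟩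
  (t + n) ⊓ m              ≡⟨ ⊓-comm (t + n) m ⟩
  m ⊓ (t + n)              ∎
  where open ≡-Reasoning

maximum-attained : ∀ {k} (g : Fin (suc k) → ℕ) → ∃[ i ] (∀ j → g j ≤ g i)
maximum-attained {zero}  g = zero , λ { zero → ≤-refl }
maximum-attained {suc k} g with maximum-attained (g ∘ suc)
... | i , max with ≤-total (g zero) (g (suc i))
...   | inj₁ g0≤gi = suc i , λ { zero → g0≤gi ; (suc j) → max j }
...   | inj₂ gi≤g0 = zero  , λ { zero → ≤-refl ; (suc j) → ≤-trans (max j) gi≤g0 }

colexRank : ℕ → ℕ → ℕ
colexRank a b = (a ⊔ b) C 2 + a ⊓ b

colexRank-comm : ∀ a b → colexRank a b ≡ colexRank b a
colexRank-comm a b = cong₂ _+_ (cong (_C 2) (⊔-comm a b)) (⊓-comm a b)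

colexRank-> : ∀ {a b} → b < a → colexRank a b ≡ a C 2 + b
colexRank-> b<a = cong₂ _+_ (cong (_C 2) (m≥n⇒m⊔n≡m (<⇒≤ b<a))) (m≥n⇒m⊓n≡n (<⇒≤ b<a))

C2≤colexRank : ∀ a b → a C 2 ≤ colexRank a b
C2≤colexRank a b = ≤-trans (C2-mono (m≤m⊔n a b)) (m≤m+n _ _)

Adjacent : ℕ → ℕ → ℕ → Set
Adjacent m a b = a ≢ b × colexRank a b < m

adjacent? : ∀ m a b → Dec (Adjacent m a b)
adjacent? m a b = ¬? (a ≟ b) ×-dec (colexRank a b <? m)

Adjacent-sym : ∀ {m a b} → Adjacent m a b → Adjacent m b a
Adjacent-sym {m} {a} {b} (a≢b , r<m) = ≢-sym a≢b , subst (_< m) (colexRank-comm a b) r<m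

colexGraph : ℕ → ∀ n → Graph n
colexGraph m n = record
  { adj    = λ i j → does (adjacent? m (toℕ i) (toℕ j))
  ; sym    = λ i j → does-⇔ (mk⇔ Adjacent-sym Adjacent-sym)
                       (adjacent? m (toℕ i) (toℕ j)) (adjacent? m (toℕ j) (toℕ i))
  ; irrefl = λ i → dec-false (adjacent? m (toℕ i) (toℕ i)) (λ (i≢i , _) → i≢i refl)
  }

sumFin≡sum : ∀ {n} (f : Fin n → ℕ) → sumFin f ≡ sum f
sumFin≡sum {zero}  f = refl
sumFin≡sum {suc n} f = cong (f zero +_) (sumFin≡sum (f ∘ suc))

sum-toℕ-suc : ∀ n (g : ℕ → ℕ) → sum {suc n} (g ∘ toℕ) ≡ sum {n} (g ∘ toℕ) + g n
sum-toℕ-suc n g = trans (sum-init-last (g ∘ toℕ))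
  (cong₂ _+_ (sum-cong-≗ {n} (cong g ∘ toℕ-inject₁)) (cong g (toℕ-fromℕ n)))

indicator : Bool → ℕ
indicator b = if b then 1 else 0

count-below : ∀ n x → sum {n} (λ j → indicator (toℕ j <ᵇ x)) ≡ n ⊓ x
count-below zero    x = refl
count-below (suc n) x = begin
  sum {suc n} (λ j → indicator (toℕ j <ᵇ x))
    ≡⟨ sum-toℕ-suc n (λ b → indicator (b <ᵇ x)) ⟩
  sum {n} (λ j → indicator (toℕ j <ᵇ x)) + indicator (n <ᵇ x)
    ≡⟨ cong (_+ indicator (n <ᵇ x)) (count-below n x) ⟩
  n ⊓ x + indicator (n <ᵇ x)
    ≡⟨ last-step (n <? x) ⟩
  suc n ⊓ x ∎
  where
  open ≡-Reasoning
  last-step : Dec (n < x) → n ⊓ x + indicator (n <ᵇ x) ≡ suc n ⊓ x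
  last-step (yes n<x) rewrite dec-true (n <? x) n<x | m≤n⇒m⊓n≡m (<⇒≤ n<x) | m≤n⇒m⊓n≡m n<x
    = +-comm n 1
  last-step (no n≮x) rewrite dec-false (n <? x) n≮x | m≥n⇒m⊓n≡n (≮⇒≥ n≮x)
    | m≥n⇒m⊓n≡n (m≤n⇒m≤1+n (≮⇒≥ n≮x)) = +-identityʳ x

row-entry : ∀ m a b → (b <ᵇ a) ∧ does (adjacent? m a b) ≡ (b <ᵇ a ⊓ (m ∸ a C 2))
row-entry m a b = does-⇔ (mk⇔ to from) (b <? a ×-dec adjacent? m a b) (b <? a ⊓ (m ∸ a C 2))
  where
  to : b < a × Adjacent m a b → b < a ⊓ (m ∸ a C 2)
  to (b<a , _ , ab<m) = ⊓-glb b<a (+<⇒<∸ (a C 2) (subst (_< m) (colexRank-> b<a) ab<m))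
  from : b < a ⊓ (m ∸ a C 2) → b < a × Adjacent m a b
  from b<min = b<a , ≢-sym (<⇒≢ b<a) ,
    subst (_< m) (sym (colexRank-> b<a)) (<∸⇒+< (a C 2) (m<n⊓o⇒m<o a (m ∸ a C 2) b<min))
    where b<a = m<n⊓o⇒m<n a (m ∸ a C 2) b<min

row-sum : ∀ m n (i : Fin n) →
  sumFin (λ j → indicator ((toℕ j <ᵇ toℕ i) ∧ adj (colexGraph m n) i j)) ≡ toℕ i ⊓ (m ∸ toℕ i C 2)
row-sum m n i = begin
  sumFin (λ j → indicator ((toℕ j <ᵇ a) ∧ adj (colexGraph m n) i j))
    ≡⟨ sumFin≡sum {n} _ ⟩
  sum {n} (λ j → indicator ((toℕ j <ᵇ a) ∧ adj (colexGraph m n) i j))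
    ≡⟨ sum-cong-≗ {n} (cong indicator ∘ row-entry m a ∘ toℕ) ⟩
  sum {n} (λ j → indicator (toℕ j <ᵇ a ⊓ (m ∸ a C 2)))
    ≡⟨ count-below n (a ⊓ (m ∸ a C 2)) ⟩
  n ⊓ (a ⊓ (m ∸ a C 2))
    ≡⟨ m≥n⇒m⊓n≡n (≤-trans (m⊓n≤m a (m ∸ a C 2)) (<⇒≤ (toℕ<n i))) ⟩
  a ⊓ (m ∸ a C 2) ∎
  where
  open ≡-Reasoning
  a = toℕ i

sum-row-counts : ∀ m n → sum {n} (λ i → toℕ i ⊓ (m ∸ toℕ i C 2)) ≡ m ⊓ (n C 2)
sum-row-counts m zero    = sym (⊓-zeroʳ m)
sum-row-counts m (suc n) = begin
  sum {suc n} (λ i → toℕ i ⊓ (m ∸ toℕ i C 2))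
    ≡⟨ sum-toℕ-suc n (λ a → a ⊓ (m ∸ a C 2)) ⟩
  sum {n} (λ i → toℕ i ⊓ (m ∸ toℕ i C 2)) + n ⊓ (m ∸ n C 2)
    ≡⟨ cong (_+ n ⊓ (m ∸ n C 2)) (sum-row-counts m n) ⟩
  m ⊓ (n C 2) + n ⊓ (m ∸ n C 2)
    ≡⟨ ⊓-+-∸ m (n C 2) n ⟩
  m ⊓ (n C 2 + n)
    ≡⟨ cong (m ⊓_) (suc-C2 n) ⟨
  m ⊓ (suc n C 2) ∎
  where open ≡-Reasoning

edges-colexGraph : ∀ m n → edges (colexGraph m n) ≡ m ⊓ (n C 2)
edges-colexGraph m n = begin
  edges (colexGraph m n)
    ≡⟨ sumFin≡sum {n} _ ⟩
  sum {n} (λ i → sumFin (λ j → indicator ((toℕ j <ᵇ toℕ i) ∧ adj (colexGraph m n) i j)))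
    ≡⟨ sum-cong-≗ {n} (row-sum m n) ⟩
  sum {n} (λ i → toℕ i ⊓ (m ∸ toℕ i C 2))
    ≡⟨ sum-row-counts m n ⟩
  m ⊓ (n C 2) ∎
  where open ≡-Reasoning

Adjacent⇒clique-below : ∀ {m x y u v} → Adjacent m x y → u ≢ v → u < x → v < x → Adjacent m u v
Adjacent⇒clique-below {m} {x} {y} {u} {v} (_ , xy<m) u≢v u<x v<x = u≢v , (begin-strict
  (u ⊔ v) C 2 + u ⊓ v      <⟨ +-monoʳ-< ((u ⊔ v) C 2) (⊓<⊔ u≢v) ⟩
  (u ⊔ v) C 2 + (u ⊔ v)    ≡⟨ suc-C2 (u ⊔ v) ⟨
  suc (u ⊔ v) C 2          ≤⟨ C2-mono (⊔-lub u<x v<x) ⟩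
  x C 2                    ≤⟨ C2≤colexRank x y ⟩
  colexRank x y            <⟨ xy<m ⟩
  m                        ∎)
  where open ≤-Reasoning

does-true⇒ : ∀ {P : Set} (d : Dec P) → does d ≡ true → P
does-true⇒ (yes p) _ = p

colexGraph-clique-below : ∀ {m n} {x y u v : Fin n} →
  adj (colexGraph m n) x y ≡ true → u ≢ v → toℕ u < toℕ x → toℕ v < toℕ x →
  adj (colexGraph m n) u v ≡ true
colexGraph-clique-below {m} {x = x} {y} {u} {v} xy u≢v u<x v<x =
  dec-true (adjacent? m (toℕ u) (toℕ v))
    (Adjacent⇒clique-below (does-true⇒ (adjacent? m (toℕ x) (toℕ y)) xy) (u≢v ∘ toℕ-injective) u<x v<x)

-- Every induced subgraph of a colex graph is a clique, one vertex joined to part of it, and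
-- isolated vertices; H avoids this shape because no vertex of H can be its top vertex.
Obstruction : ∀ {k} → (Fin k → Fin k → Bool) → Set
Obstruction H = ∀ i → (∃[ j ] H i j ≡ true) × (∃₂ λ u v → u ≢ v × u ≢ i × v ≢ i × H u v ≡ false)

missing-edge : ∀ {k n} {H : Fin (suc k) → Fin (suc k) → Bool} → Obstruction H → ∀ m →
  (f : Fin (suc k) → Fin n) → Injective _≡_ _≡_ f →
  (∀ a b → H a b ≡ true → adj (colexGraph m n) (f a) (f b) ≡ true) →
  ∃₂ λ u v → u ≢ v × H u v ≡ false × adj (colexGraph m n) (f u) (f v) ≡ true
missing-edge obstruction m f f-inj edges-preserved with maximum-attained (toℕ ∘ f)
... | top , top-max with obstruction top
...   | (j , Htj) , u , v , u≢v , u≢top , v≢top , Huv =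
  u , v , u≢v , Huv ,
  colexGraph-clique-below {m} (edges-preserved top j Htj) (u≢v ∘ f-inj) (below u≢top) (below v≢top)
  where
  below : ∀ {w} → w ≢ top → toℕ (f w) < toℕ (f top)
  below {w} w≢top = ≤∧≢⇒< (top-max w) (w≢top ∘ f-inj ∘ toℕ-injective)

obstruction⇒free : ∀ {k} {H : Fin (suc k) → Fin (suc k) → Bool} →
  Obstruction H → ∀ m n → Free H (colexGraph m n)
obstruction⇒free obstruction m n (f , f-inj , induced)
  with missing-edge obstruction m f f-inj (λ a b Hab → trans (induced a b) Hab)
... | u , v , _ , Huv , uv with trans (sym Huv) (trans (sym (induced u v)) uv)
... | ()

restrictˡ : ∀ {p} k → (Fin (p + k) → Fin (p + k) → Bool) → Fin p → Fin p → Bool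
restrictˡ k H a b = H (a ↑ˡ k) (b ↑ˡ k)

Free-restrictˡ : ∀ {p k n} {H : Fin (p + k) → Fin (p + k) → Bool} {G : Graph n} →
  Free (restrictˡ k H) G → Free H G
Free-restrictˡ {k = k} free (f , f-inj , induced) =
  free (f ∘ (_↑ˡ k) , ↑ˡ-injective k _ _ ∘ f-inj , λ a b → induced (a ↑ˡ k) (b ↑ˡ k))

star-obstruction : ∀ k → Obstruction (restrictˡ {4} k (star (3 + k)))
star-obstruction k 0F = (1F , refl) , 1F , 2F , (λ ()) , (λ ()) , (λ ()) , refl
star-obstruction k 1F = (0F , refl) , 2F , 3F , (λ ()) , (λ ()) , (λ ()) , refl
star-obstruction k 2F = (0F , refl) , 1F , 3F , (λ ()) , (λ ()) , (λ ()) , refl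
star-obstruction k 3F = (0F , refl) , 1F , 2F , (λ ()) , (λ ()) , (λ ()) , refl

path-obstruction : ∀ k → Obstruction (restrictˡ {4} k (path (3 + k)))
path-obstruction k 0F = (1F , refl) , 1F , 3F , (λ ()) , (λ ()) , (λ ()) , refl
path-obstruction k 1F = (0F , refl) , 0F , 2F , (λ ()) , (λ ()) , (λ ()) , refl
path-obstruction k 2F = (1F , refl) , 0F , 3F , (λ ()) , (λ ()) , (λ ()) , refl
path-obstruction k 3F = (2F , refl) , 0F , 2F , (λ ()) , (λ ()) , (λ ()) , refl

matching-obstruction : ∀ k → Obstruction (restrictˡ {4} (k * 2) (matching (2 + k)))
matching-obstruction k 0F = (1F , refl) , 1F , 2F , (λ ()) , (λ ()) , (λ ()) , refl
matching-obstruction k 1F = (0F , refl) , 0F , 2F , (λ ()) , (λ ()) , (λ ()) , refl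
matching-obstruction k 2F = (3F , refl) , 0F , 3F , (λ ()) , (λ ()) , (λ ()) , refl
matching-obstruction k 3F = (2F , refl) , 0F , 2F , (λ ()) , (λ ()) , (λ ()) , refl

-- The pair {0, 3} is avoided: it is an edge of the cycle exactly when k = 0.
cycle-obstruction : ∀ k → Obstruction (restrictˡ {4} k (cycAdj (4 + k)))
cycle-obstruction k 0F = (1F , refl) , 1F , 3F , (λ ()) , (λ ()) , (λ ()) , refl
cycle-obstruction k 1F = (0F , refl) , 0F , 2F , (λ ()) , (λ ()) , (λ ()) , refl
cycle-obstruction k 2F = (1F , refl) , 1F , 3F , (λ ()) , (λ ()) , (λ ()) , refl
cycle-obstruction k 3F = (2F , refl) , 0F , 2F , (λ ()) , (λ ()) , (λ ()) , refl

colexGraph-star-free : ∀ r → 3 ≤ r → ∀ m n → Free (star r) (colexGraph m n)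
colexGraph-star-free (suc (suc (suc k))) (s≤s (s≤s (s≤s _))) m n =
  Free-restrictˡ {4} {k} {G = colexGraph m n} (obstruction⇒free (star-obstruction k) m n)

colexGraph-path-free : ∀ r → 3 ≤ r → ∀ m n → Free (path r) (colexGraph m n)
colexGraph-path-free (suc (suc (suc k))) (s≤s (s≤s (s≤s _))) m n =
  Free-restrictˡ {4} {k} {G = colexGraph m n} (obstruction⇒free (path-obstruction k) m n)

colexGraph-matching-free : ∀ r → 2 ≤ r → ∀ m n → Free (matching r) (colexGraph m n)
colexGraph-matching-free (suc (suc k)) (s≤s (s≤s _)) m n =
  Free-restrictˡ {4} {k * 2} {G = colexGraph m n} (obstruction⇒free (matching-obstruction k) m n)

colexGraph-chordal : ∀ m n → Chordal (colexGraph m n)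
colexGraph-chordal m n (suc (suc (suc (suc k)))) (s≤s (s≤s (s≤s (s≤s _)))) f f-inj cycle =
  let u , v , u≢v , non-consecutive , chord =
        missing-edge (cycle-obstruction k) m (f ∘ (_↑ˡ k)) (↑ˡ-injective k _ _ ∘ f-inj)
          (λ a b → cycle (a ↑ˡ k) (b ↑ˡ k))
  in u ↑ˡ k , v ↑ˡ k , u≢v ∘ ↑ˡ-injective k u v , non-consecutive , chord

feasible : {F : ∀ {n} → Graph n → Set} → (∀ m n → F (colexGraph m n)) → Feasible F
feasible holds n _ m m≤nC2 =
  colexGraph m n , holds m n , trans (edges-colexGraph m n) (m≤n⇒m⊓n≡m m≤nC2)

mainTheorem4 :
    (∀ r → 3 ≤ r → Feasible (Free (star r)))
    × (∀ r → 3 ≤ r → Feasible (Free (path r)))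
    × (∀ r → 2 ≤ r → Feasible (Free (matching r)))
    × Feasible Chordal
mainTheorem4 =
    (λ r 3≤r → feasible (colexGraph-star-free r 3≤r))
  , (λ r 3≤r → feasible (colexGraph-path-free r 3≤r))
  , (λ r 2≤r → feasible (colexGraph-matching-free r 2≤r))
  , feasible colexGraph-chordal
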